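{- Let $\Phi$ be a derivation in system $\mathcal{N}$ of $\Gamma\vdash^{(m,e,s)} t:\sigma$ such that $\Gamma$ is tight. If $t\in\mathsf{ne}_n$, then $\sigma$ is a tight type (i.e.\ $\sigma\in\{\mathtt{n},\mathtt{a}\}$).
   Context: Terms are $t,u,r ::= x \mid \lambda x.t \mid t\,u \mid t[x\backslash u]$ over a countably infinite set of variables, where $t[x\backslash u]$ (explicit substitution) binds $x$ in $t$; terms are taken modulo $\alpha$-conversion. CBN neutral terms: $\mathsf{ne}_n ::= x \mid \mathsf{ne}_n\,t$. Types. Tight types: $\mathtt{tt} ::= \mathtt{n} \mid \mathtt{a}$. Types: $\sigma,\tau ::= \mathtt{tt} \mid \mathcal{M} \mid \mathcal{M}\to\sigma$, where multitypes $\mathcal{M} = [\sigma_i]_{i\in I}$ are finite multisets of types ($[\,]$ empty, $\sqcup$ union). A typing context $\Gamma$ maps variables to multitypes, $[\,]$ for all but finitely many; $\mathrm{dom}(\Gamma)=\{x \mid \Gamma(x)\neq[\,]\}$; $(\Gamma+\Delta)(x) = \Gamma(x)\sqcup\Delta(x)$, extended to finite sums $+_{i\in I}\Gamma_i$; $\Gamma\setminus\!\!\setminus x$ maps $x$ to $[\,]$ and agrees with $\Gamma$ elsewhere; $\Gamma; x:\mathcal{M}$ maps $x$ to $\mathcal{M}$ and agrees with $\Gamma$ elsewhere, where $x\notin\mathrm{dom}(\Gamma)$. Judgements $\Gamma \vdash^{(m,e,s)} t:\sigma$ carry natural-number counters. System $\mathcal{N}$ consists of the rules: (app$_p$) from $\Gamma\vdash^{(m,e,s)}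 t:\mathtt{n}$ infer $\Gamma\vdash^{(m,e,s+1)} t\,u:\mathtt{n}$; (abs$_p$) from $\Gamma\vdash^{(m,e,s)} t:\mathtt{tt}$ (a tight type) with $\Gamma(x)$ tight, infer $\Gamma\setminus\!\!\setminus x\vdash^{(m,e,s+1)}\lambda x.t:\mathtt{a}$; (var$_c$) $x:[\sigma]\vdash^{(0,0,0)} x:\sigma$; (abs$_c$) from $\Gamma\vdash^{(m,e,s)} t:\tau$ infer $\Gamma\setminus\!\!\setminus x\vdash^{(m,e,s)}\lambda x.t:\Gamma(x)\to\tau$; (app$_c$) from $\Gamma\vdash^{(m,e,s)} t:[\sigma_i]_{i\in I}\to\tau$ and $\Delta_i\vdash^{(m_i,e_i,s_i)} u:\sigma_i$ for each $i\in I$, infer $\Gamma+_{i\in I}\Delta_i\vdash^{(1+m+\sum_i m_i,\,1+e+\sum_i e_i,\,s+\sum_i s_i)} t\,u:\tau$; (es$_c$) from $\Gamma;x:[\sigma_i]_{i\in I}\vdash^{(m,e,s)} t:\tau$ and $\Delta_i\vdash^{(m_i,e_i,s_i)} u:\sigma_i$ for each $i\in I$, infer $(\Gamma\setminus\!\!\setminus x)+_{i\in I}\Delta_i\vdash^{(m+\sum_i m_i,\,1+e+\sum_i e_i,\,s+\sum_i s_i)} t[x\backslash u]:\tau$. A multitype is tight if all its elements are tight types; a context is tight if all multitypes it assigns are tight. -}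

module Defs where

open import Data.Nat using (ℕ; zero; suc; _+_; _≡ᵇ_)
open import Data.Bool using (if_then_else_)
open import Data.List using (List; []; _∷_; _++_)
open import Data.List.Relation.Unary.All using (All)

data Tm : Set where
  var : ℕ → Tm
  lam : ℕ → Tm → Tm
  app : Tm → Tm → Tm
  es  : Tm → ℕ → Tm → Tm       -- t [ x \ u ]

data Neutral : Tm → Set where
  ne-var : ∀ x → Neutral (var x)
  ne-app : ∀ {t} u → Neutral t → Neutral (app t u)

-- Types; a multitype is represented by a list (considered up to permutation, see _≈ₘ_)
data Ty : Set where
  tn  : Ty
  ta  : Ty
  mty : List Ty → Ty
  _⇒_ : List Ty → Ty → Ty

MTy : Set
MTy = List Ty

data Tight : Ty → Set where
  tight-n : Tight tn
  tight-a : Tight ta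

TightM : MTy → Set
TightM M = All Tight M

mutual
  data _≈_ : Ty → Ty → Set where
    ≈-n   : tn ≈ tn
    ≈-a   : ta ≈ ta
    ≈-mty : ∀ {M N} → M ≈ₘ N → mty M ≈ mty N
    ≈-⇒   : ∀ {M N σ τ} → M ≈ₘ N → σ ≈ τ → (M ⇒ σ) ≈ (N ⇒ τ)

  data _≈ₘ_ : MTy → MTy → Set where
    ≈ₘ-[]    : [] ≈ₘ []
    ≈ₘ-∷     : ∀ {σ τ M N} → σ ≈ τ → M ≈ₘ N → (σ ∷ M) ≈ₘ (τ ∷ N)
    ≈ₘ-swap  : ∀ {σ τ M} → (σ ∷ τ ∷ M) ≈ₘ (τ ∷ σ ∷ M)
    ≈ₘ-trans : ∀ {M N P} → M ≈ₘ N → N ≈ₘ P → M ≈ₘ P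

Ctx : Set
Ctx = ℕ → MTy

∅ : Ctx
∅ _ = []

_+ᶜ_ : Ctx → Ctx → Ctx
(Γ +ᶜ Δ) y = Γ y ++ Δ y

_∖∖_ : Ctx → ℕ → Ctx
(Γ ∖∖ x) y = if y ≡ᵇ x then [] else Γ y

_∶[_] : ℕ → Ty → Ctx
(x ∶[ σ ]) y = if y ≡ᵇ x then σ ∷ [] else []

TightCtx : Ctx → Set
TightCtx Γ = ∀ x → TightM (Γ x)

mutual
  data _⊢⟨_,_,_⟩_∶_ : Ctx → ℕ → ℕ → ℕ → Tm → Ty → Set where
    app-p : ∀ {Γ m e s t u} →
      Γ ⊢⟨ m , e , s ⟩ t ∶ tn →
      Γ ⊢⟨ m , e , suc s ⟩ app t u ∶ tn
    abs-p : ∀ {Γ m e s t x τ} →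
      Tight τ → TightM (Γ x) →
      Γ ⊢⟨ m , e , s ⟩ t ∶ τ →
      (Γ ∖∖ x) ⊢⟨ m , e , suc s ⟩ lam x t ∶ ta
    var-c : ∀ {x σ} →
      (x ∶[ σ ]) ⊢⟨ 0 , 0 , 0 ⟩ var x ∶ σ
    abs-c : ∀ {Γ m e s t x τ} →
      Γ ⊢⟨ m , e , s ⟩ t ∶ τ →
      (Γ ∖∖ x) ⊢⟨ m , e , s ⟩ lam x t ∶ (Γ x ⇒ τ)
    app-c : ∀ {Γ Δ m e s m' e' s' t u M τ} →
      Γ ⊢⟨ m , e , s ⟩ t ∶ (M ⇒ τ) →
      Args Δ m' e' s' u M →
      (Γ +ᶜ Δ) ⊢⟨ suc (m + m') , suc (e + e') , s + s' ⟩ app t u ∶ τ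
    es-c : ∀ {Γ Δ m e s m' e' s' t u x τ} →
      Γ ⊢⟨ m , e , s ⟩ t ∶ τ →
      Args Δ m' e' s' u (Γ x) →
      ((Γ ∖∖ x) +ᶜ Δ) ⊢⟨ m + m' , suc (e + e') , s + s' ⟩ es t x u ∶ τ

  -- Args Δ m e s u [σ_i]_{i∈I}: a family of derivations Δ_i ⊢ u : σ_i (i ∈ I),
  -- with Δ = +_i Δ_i and counters summed.  Each σ_i is matched up to _≈_.
  data Args : Ctx → ℕ → ℕ → ℕ → Tm → MTy → Set where
    args-[] : ∀ {u} → Args ∅ 0 0 0 u []
    args-∷  : ∀ {Δ Δ' m e s m' e' s' u σ σ' M} →
      Δ ⊢⟨ m , e , s ⟩ u ∶ σ' → σ' ≈ σ →
      Args Δ' m' e' s' u M →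
      Args (Δ +ᶜ Δ') (m + m') (e + e') (s + s') u (σ ∷ M)

-- By induction on the neutral term: a variable gets its type from the tight
-- context, and an application t u of a neutral t is typed either by app-p,
-- giving n, or by app-c, which would require t to have an arrow type,
-- contradicting the induction hypothesis.
module Submission where

open import Defs
open import Data.Nat using (ℕ; zero; suc)
open import Data.List using (_∷_; [])
open import Data.List.Relation.Unary.All using (head)
open import Data.List.Relation.Unary.All.Properties using (++⁻ˡ)
open import Relation.Binary.PropositionalEquality using (_≡_; refl; subst)

∶[]-self : ∀ x σ → (x ∶[ σ ]) x ≡ σ ∷ []
∶[]-self zero    σ = refl
∶[]-self (suc x) σ = ∶[]-self x σ

TightCtx-∶[]⁻ : ∀ x {σ} → TightCtx (x ∶[ σ ]) → Tight σ
TightCtx-∶[]⁻ x {σ} tight = head (subst TightM (∶[]-self x σ) (tight x))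

TightCtx-+ᶜˡ : ∀ Γ {Δ} → TightCtx (Γ +ᶜ Δ) → TightCtx Γ
TightCtx-+ᶜˡ Γ tight y = ++⁻ˡ (Γ y) (tight y)

lemma3p1 : ∀ {Γ : Ctx} {m e s : ℕ} {t : Tm} {σ : Ty} →
    Γ ⊢⟨ m , e , s ⟩ t ∶ σ → TightCtx Γ → Neutral t → Tight σ
lemma3p1 var-c           tight (ne-var x)    = TightCtx-∶[]⁻ x tight
lemma3p1 (app-p _)       _     (ne-app _ _)  = tight-n
lemma3p1 (app-c {Γ = Γ} ⊢t _) tight (ne-app _ ne)
  with lemma3p1 ⊢t (TightCtx-+ᶜˡ Γ tight) ne
... | ()
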